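{- Let $G$ be a finite abelian group of order $n\ge 2$, and suppose that $m$ and $h$ are integers for which $C_{h+1}(G)\le m\le C_h(G)$. Then $C_{m-h}(G)=m$.
   Context: $G$ is written additively. For $A\subseteq G$ and a nonnegative integer $h$, $h\hat{\;}A$ denotes the set of all sums of $h$ pairwise distinct elements of $A$ (with the convention that the empty sum is $0$, so $0\hat{\;}A=\{0\}$, and $h\hat{\;}A=\emptyset$ if $h>|A|$). $C_h(G)=\max\{|A| : A\subseteq G,\ h\hat{\;}A\neq G\}$. -}

module Defs where

open import Data.Nat using (ℕ; _≤_)
open import Data.Fin using (Fin)
open import Data.Fin.Subset using (Subset; _⊆_; ∣_∣; inside; outside)
open import Data.List using (List; foldr; allFin)
open import Data.Vec using (lookup)
open import Data.Bool using (if_then_else_)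
open import Data.Product using (Σ; ∃; _×_)
open import Relation.Nullary using (¬_)
open import Relation.Binary.PropositionalEquality using (_≡_)
open import Algebra.Structures using (IsAbelianGroup)

-- A finite abelian group of order n, presented (up to isomorphism) on the
-- carrier Fin n, with propositional equality.
record FinAbelianGroup (n : ℕ) : Set where
  field
    _+_ : Fin n → Fin n → Fin n
    0#  : Fin n
    -_  : Fin n → Fin n
    isAbelianGroup : IsAbelianGroup _≡_ _+_ 0# -_

module _ {n : ℕ} (G : FinAbelianGroup n) where
  open FinAbelianGroup G

  subsetSum : Subset n → Fin n
  subsetSum B = foldr (λ i acc → if lookup B i then i + acc else acc) 0# (allFin n)

  InRestrictedSumset : ℕ → Subset n → Fin n → Set
  InRestrictedSumset h A x = Σ (Subset n) λ B → B ⊆ A × ∣ B ∣ ≡ h × subsetSum B ≡ x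

  NotCovering : ℕ → Subset n → Set
  NotCovering h A = ¬ (∀ (g : Fin n) → InRestrictedSumset h A g)

  -- C_h(G) = c : c is the maximum of |A| over A ⊆ G with h^A ≠ G
  IsC : ℕ → ℕ → Set
  IsC h c = (Σ (Subset n) λ A → ∣ A ∣ ≡ c × NotCovering h A)
          × (∀ (A : Subset n) → NotCovering h A → ∣ A ∣ ≤ c)

{-# OPTIONS --safe #-}
module Submission where

-- Complementing inside A sends a j-element subset with sum g to an
-- (|A| − j)-element subset with sum Σ A − g, so (|A| − j)^A ≠ G whenever
-- j^A ≠ G.  For h ≤ m, shrinking an extremal set for C_h to m elements and
-- complementing gives (m − h)^A ≠ G with |A| = m; conversely m + 1 elements B
-- with (m − h)^B ≠ G would complement to (h + 1)^B ≠ G, against C_{h+1} ≤ m.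
-- For m < h, any min(h, n) elements miss all (h + 1)-fold sums, which forces
-- m = n = C_0(G).

open import Defs
open import Data.Nat using (ℕ; zero; suc; _+_; _≤_; _<_; _∸_; _⊓_; s≤s)
open import Data.Nat.Properties
  using (_≤?_; ≤-trans; ≤-antisym; <⇒≱; ≰⇒>; ≰⇒≥; 1+n≰n; +-suc; +-cancelʳ-≡;
         m⊓n≤m; m⊓n≤n; ⊓-sel; m+[n∸m]≡n; m∸n+n≡m; m≤n⇒m∸n≡0)
open import Data.Bool using (true; false; if_then_else_)
open import Data.Fin using (Fin) renaming (zero to fzero; suc to fsuc)
open import Data.Fin.Subset using (Subset; _⊆_; ∣_∣; inside; outside; _─_; ⊤; ⊥)
open import Data.Fin.Subset.Properties
  using (s⊆s; ⊥⊆; drop-∷-⊆; ∣⊥∣≡0; ∣⊤∣≡n; ∣p∣≤n; p─q⊆p; p⊆q⇒∣p∣≤∣q∣)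
open import Data.Vec using (_∷_; []; lookup; here)
open import Data.Vec.Properties using ([]=⇒lookup; lookup⇒[]=; lookup-replicate)
open import Data.List using (List; []; _∷_; foldr; allFin)
open import Data.Product using (∃; _×_; _,_)
open import Data.Sum using (inj₁; inj₂)
open import Relation.Nullary using (yes; no; contradiction)
open import Relation.Binary.PropositionalEquality
  using (_≡_; _≢_; refl; sym; trans; cong; subst; subst₂; module ≡-Reasoning)
open import Algebra.Bundles using (AbelianGroup)
import Algebra.Properties.Group as GroupProperties
import Algebra.Properties.CommutativeSemigroup as CommutativeSemigroupProperties

k≤∣p∣⇒∃q⊆p∧∣q∣≡k : ∀ {n} k (p : Subset n) → k ≤ ∣ p ∣ → ∃ λ q → q ⊆ p × ∣ q ∣ ≡ k
k≤∣p∣⇒∃q⊆p∧∣q∣≡k {n} zero p _ = ⊥ , ⊥⊆ , ∣⊥∣≡0 n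
k≤∣p∣⇒∃q⊆p∧∣q∣≡k k (outside ∷ p) k≤∣p∣ with k≤∣p∣⇒∃q⊆p∧∣q∣≡k k p k≤∣p∣
... | q , q⊆p , ∣q∣≡k = outside ∷ q , s⊆s q⊆p , ∣q∣≡k
k≤∣p∣⇒∃q⊆p∧∣q∣≡k (suc k) (inside ∷ p) (s≤s k≤∣p∣) with k≤∣p∣⇒∃q⊆p∧∣q∣≡k k p k≤∣p∣
... | q , q⊆p , ∣q∣≡k = inside ∷ q , s⊆s q⊆p , cong suc ∣q∣≡k

∣p─q∣+∣q∣≡∣p∣ : ∀ {n} (p q : Subset n) → q ⊆ p → ∣ p ─ q ∣ + ∣ q ∣ ≡ ∣ p ∣
∣p─q∣+∣q∣≡∣p∣ []            []            _   = refl
∣p─q∣+∣q∣≡∣p∣ (outside ∷ p) (outside ∷ q) q⊆p = ∣p─q∣+∣q∣≡∣p∣ p q (drop-∷-⊆ q⊆p)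
∣p─q∣+∣q∣≡∣p∣ (inside  ∷ p) (outside ∷ q) q⊆p = cong suc (∣p─q∣+∣q∣≡∣p∣ p q (drop-∷-⊆ q⊆p))
∣p─q∣+∣q∣≡∣p∣ (outside ∷ p) (inside  ∷ q) q⊆p with q⊆p here
... | ()
∣p─q∣+∣q∣≡∣p∣ (inside  ∷ p) (inside  ∷ q) q⊆p =
  trans (+-suc ∣ p ─ q ∣ ∣ q ∣) (cong suc (∣p─q∣+∣q∣≡∣p∣ p q (drop-∷-⊆ q⊆p)))

∣p∣≡0⇒p≡⊥ : ∀ {n} (p : Subset n) → ∣ p ∣ ≡ 0 → p ≡ ⊥
∣p∣≡0⇒p≡⊥ []            _      = refl
∣p∣≡0⇒p≡⊥ (outside ∷ p) ∣p∣≡0 = cong (outside ∷_) (∣p∣≡0⇒p≡⊥ p ∣p∣≡0)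

lookup-─ : ∀ {n} (p q : Subset n) i →
           lookup (p ─ q) i ≡ (if lookup q i then outside else lookup p i)
lookup-─ (_ ∷ p) (inside  ∷ q) fzero    = refl
lookup-─ (_ ∷ p) (outside ∷ q) fzero    = refl
lookup-─ (_ ∷ p) (_       ∷ q) (fsuc i) = lookup-─ p q i

module _ {n : ℕ} (G : FinAbelianGroup n) where
  open FinAbelianGroup G renaming (_+_ to _∙_)

  private
    abelianGroup : AbelianGroup _ _
    abelianGroup = record { isAbelianGroup = isAbelianGroup }

    open AbelianGroup abelianGroup using (group; commutativeSemigroup; assoc; identityˡ)
    open GroupProperties group using (\\-leftDividesˡ; ∙-cancelʳ)
    open CommutativeSemigroupProperties commutativeSemigroup using (x∙yz≈y∙xz)

    sumOver : Subset n → List (Fin n) → Fin n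
    sumOver B = foldr (λ i acc → if lookup B i then i ∙ acc else acc) 0#

    sumOver-⊥ : ∀ xs → sumOver ⊥ xs ≡ 0#
    sumOver-⊥ []       = refl
    sumOver-⊥ (i ∷ xs) rewrite lookup-replicate i false = sumOver-⊥ xs

    sumOver-─ : ∀ (A C : Subset n) → C ⊆ A → ∀ xs →
                sumOver (A ─ C) xs ∙ sumOver C xs ≡ sumOver A xs
    sumOver-─ A C C⊆A []       = identityˡ 0#
    sumOver-─ A C C⊆A (i ∷ xs) rewrite lookup-─ A C i
      with lookup A i in i∈A | lookup C i in i∈C
    ... | true  | true  = trans (x∙yz≈y∙xz _ i _) (cong (i ∙_) (sumOver-─ A C C⊆A xs))
    ... | true  | false = trans (assoc i _ _) (cong (i ∙_) (sumOver-─ A C C⊆A xs))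
    ... | false | false = sumOver-─ A C C⊆A xs
    ... | false | true  with trans (sym ([]=⇒lookup (C⊆A (lookup⇒[]= i C i∈C)))) i∈A
    ... | ()

  subsetSum-⊥ : subsetSum G ⊥ ≡ 0#
  subsetSum-⊥ = sumOver-⊥ (allFin n)

  subsetSum-─ : ∀ (A C : Subset n) → C ⊆ A → subsetSum G (A ─ C) ∙ subsetSum G C ≡ subsetSum G A
  subsetSum-─ A C C⊆A = sumOver-─ A C C⊆A (allFin n)

  NotCovering-antimono : ∀ {h} {A B : Subset n} → B ⊆ A → NotCovering G h A → NotCovering G h B
  NotCovering-antimono B⊆A ¬covA covB = ¬covA λ g →
    let (C , C⊆B , rest) = covB g in C , (λ x∈C → B⊆A (C⊆B x∈C)) , rest

  NotCovering-shrink : ∀ {h} k (A : Subset n) → k ≤ ∣ A ∣ → NotCovering G h A →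
                       ∃ λ B → ∣ B ∣ ≡ k × NotCovering G h B
  NotCovering-shrink k A k≤∣A∣ ¬covA with k≤∣p∣⇒∃q⊆p∧∣q∣≡k k A k≤∣A∣
  ... | B , B⊆A , ∣B∣≡k = B , ∣B∣≡k , NotCovering-antimono B⊆A ¬covA

  NotCovering-complement : ∀ {j k} (A : Subset n) → ∣ A ∣ ≡ j + k →
                           NotCovering G j A → NotCovering G k A
  NotCovering-complement {j} {k} A ∣A∣≡j+k ¬covA covA = ¬covA λ g →
    let (C , C⊆A , ∣C∣≡k , ΣC≡) = covA ((- g) ∙ subsetSum G A) in
    A ─ C , p─q⊆p A C , ∣A─C∣≡j C C⊆A ∣C∣≡k , ΣA─C≡ g C C⊆A ΣC≡
    where
    ∣A─C∣≡j : ∀ C → C ⊆ A → ∣ C ∣ ≡ k → ∣ A ─ C ∣ ≡ j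
    ∣A─C∣≡j C C⊆A ∣C∣≡k = +-cancelʳ-≡ k ∣ A ─ C ∣ j (begin
      ∣ A ─ C ∣ + k      ≡⟨ cong (∣ A ─ C ∣ +_) (sym ∣C∣≡k) ⟩
      ∣ A ─ C ∣ + ∣ C ∣  ≡⟨ ∣p─q∣+∣q∣≡∣p∣ A C C⊆A ⟩
      ∣ A ∣              ≡⟨ ∣A∣≡j+k ⟩
      j + k              ∎)
      where open ≡-Reasoning

    ΣA─C≡ : ∀ g C → C ⊆ A → subsetSum G C ≡ (- g) ∙ subsetSum G A → subsetSum G (A ─ C) ≡ g
    ΣA─C≡ g C C⊆A ΣC≡ = ∙-cancelʳ ((- g) ∙ subsetSum G A) (subsetSum G (A ─ C)) g (begin
      subsetSum G (A ─ C) ∙ ((- g) ∙ subsetSum G A)  ≡⟨ cong (subsetSum G (A ─ C) ∙_) (sym ΣC≡) ⟩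
      subsetSum G (A ─ C) ∙ subsetSum G C            ≡⟨ subsetSum-─ A C C⊆A ⟩
      subsetSum G A                                  ≡⟨ \\-leftDividesˡ g (subsetSum G A) ⟨
      g ∙ ((- g) ∙ subsetSum G A)                    ∎)
      where open ≡-Reasoning

  NotCovering-oversized : ∀ {h} (A : Subset n) → ∣ A ∣ < h → NotCovering G h A
  NotCovering-oversized A ∣A∣<h covA with covA 0#
  ... | B , B⊆A , ∣B∣≡h , _ = <⇒≱ ∣A∣<h (subst (_≤ ∣ A ∣) ∣B∣≡h (p⊆q⇒∣p∣≤∣q∣ B⊆A))

  InRestrictedSumset-zero : ∀ {A g} → InRestrictedSumset G 0 A g → g ≡ 0#
  InRestrictedSumset-zero (B , _ , ∣B∣≡0 , ΣB≡g) =
    trans (sym ΣB≡g) (trans (cong (subsetSum G) (∣p∣≡0⇒p≡⊥ B ∣B∣≡0)) subsetSum-⊥)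

  NotCovering-zero : 2 ≤ n → (A : Subset n) → NotCovering G 0 A
  NotCovering-zero (s≤s (s≤s _)) A covA = 0≢1 (trans (InRestrictedSumset-zero (covA fzero))
                                                     (sym (InRestrictedSumset-zero (covA (fsuc fzero)))))
    where
    0≢1 : fzero ≢ fsuc fzero
    0≢1 ()

  IsC-zero : 2 ≤ n → IsC G 0 n
  IsC-zero 2≤n = (⊤ , ∣⊤∣≡n n , NotCovering-zero 2≤n ⊤) , λ A _ → ∣p∣≤n A

  IsC⇒≤n : ∀ {h c} → IsC G h c → c ≤ n
  IsC⇒≤n ((A , ∣A∣≡c , _) , _) = subst (_≤ n) ∣A∣≡c (∣p∣≤n A)

  IsC-suc-≥⊓ : ∀ {h c} → IsC G (suc h) c → h ⊓ n ≤ c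
  IsC-suc-≥⊓ {h} (_ , maximal)
    with k≤∣p∣⇒∃q⊆p∧∣q∣≡k (h ⊓ n) ⊤ (subst (h ⊓ n ≤_) (sym (∣⊤∣≡n n)) (m⊓n≤n h n))
  ... | B , _ , ∣B∣≡h⊓n = subst (_≤ _) ∣B∣≡h⊓n (maximal B ¬cov[1+h]B)
    where
    ¬cov[1+h]B : NotCovering G (suc h) B
    ¬cov[1+h]B = NotCovering-oversized B (s≤s (subst (_≤ h) (sym ∣B∣≡h⊓n) (m⊓n≤m h n)))

  NotCovering[m∸h]⇒∣∣≤m : ∀ {h m c} → h ≤ m → IsC G (suc h) c → c ≤ m →
                          (B : Subset n) → NotCovering G (m ∸ h) B → ∣ B ∣ ≤ m
  NotCovering[m∸h]⇒∣∣≤m {h} {m} h≤m (_ , maximal) c≤m B ¬covB with ∣ B ∣ ≤? m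
  ... | yes ∣B∣≤m = ∣B∣≤m
  ... | no ∣B∣≰m with NotCovering-shrink (suc m) B (≰⇒> ∣B∣≰m) ¬covB
  ... | B′ , ∣B′∣≡1+m , ¬covB′ =
    contradiction (≤-trans (subst (_≤ _) ∣B′∣≡1+m (maximal B′ ¬cov[1+h]B′)) c≤m) 1+n≰n
    where
    ∣B′∣≡[m∸h]+[1+h] : ∣ B′ ∣ ≡ (m ∸ h) + suc h
    ∣B′∣≡[m∸h]+[1+h] = trans ∣B′∣≡1+m (sym (trans (+-suc (m ∸ h) h) (cong suc (m∸n+n≡m h≤m))))

    ¬cov[1+h]B′ : NotCovering G (suc h) B′
    ¬cov[1+h]B′ = NotCovering-complement B′ ∣B′∣≡[m∸h]+[1+h] ¬covB′

lemma2p7 : (n : ℕ) → 2 ≤ n → (G : FinAbelianGroup n) → (h m cₕ cₕ₊₁ : ℕ) →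
    IsC G h cₕ → IsC G (suc h) cₕ₊₁ → cₕ₊₁ ≤ m → m ≤ cₕ → IsC G (m ∸ h) m
lemma2p7 n 2≤n G h m cₕ cₕ₊₁ Cₕ@((A₀ , ∣A₀∣≡cₕ , ¬covA₀) , _) Cₕ₊₁ cₕ₊₁≤m m≤cₕ with h ≤? m
... | yes h≤m with NotCovering-shrink G m A₀ (subst (m ≤_) (sym ∣A₀∣≡cₕ) m≤cₕ) ¬covA₀
...   | A , ∣A∣≡m , ¬covA =
  (A , ∣A∣≡m , NotCovering-complement G A (trans ∣A∣≡m (sym (m+[n∸m]≡n h≤m))) ¬covA) ,
  NotCovering[m∸h]⇒∣∣≤m G h≤m Cₕ₊₁ cₕ₊₁≤m
lemma2p7 n 2≤n G h m cₕ cₕ₊₁ Cₕ Cₕ₊₁ cₕ₊₁≤m m≤cₕ | no h≰m =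
  subst₂ (IsC G) (sym (m≤n⇒m∸n≡0 (≰⇒≥ h≰m))) n≡m (IsC-zero G 2≤n)
  where
  h⊓n≤m : h ⊓ n ≤ m
  h⊓n≤m = ≤-trans (IsC-suc-≥⊓ G Cₕ₊₁) cₕ₊₁≤m

  n≤m : n ≤ m
  n≤m with ⊓-sel h n
  ... | inj₁ h⊓n≡h = contradiction (subst (_≤ m) h⊓n≡h h⊓n≤m) h≰m
  ... | inj₂ h⊓n≡n = subst (_≤ m) h⊓n≡n h⊓n≤m

  n≡m : n ≡ m
  n≡m = ≤-antisym n≤m (≤-trans m≤cₕ (IsC⇒≤n G Cₕ))
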